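{- Let $T$ be an indexed tree and $M=\max(\mathrm{Supp}(T))$. Then $$\mathfrak{P}_T(1,1,\dots)=|\mathrm{Dec}(T,M)|=\binom{M}{|T|}\,|\mathrm{Dec}(T)|.$$
   Context: An indexed tree $T$ with support an interval $[a,b]\subset\mathbb{Z}$ is a plane binary tree with $b-a+1$ nodes, canonically labeled by $[a,b]$ in inorder (missing children are leaves). $|T|$ is its number of nodes. $\rho_T(v)$ is the canonical label of the node reached from $v$ by following left children as long as possible. The forest polynomial is $\mathfrak{P}_T=\sum_\kappa\prod_vx_{\kappa(v)}$ over $\kappa:\operatorname{IN}(T)\to\mathbb{Z}_{\ge1}$ with $\kappa(v)\le\rho_T(v)$, $\kappa(\text{left child of }u)\ge\kappa(u)$, and $\kappa(\text{right child of }u)>\kappa(u)$; $\mathfrak{P}_T(1,1,\dots)$ is its evaluation at all $x_i=1$. $\mathrm{Dec}(T,M)$ is the set of injective labelings of the nodes of $T$ by elements of $[M]=\{1,\dots,M\}$ in which every node has a larger label than its children, and $\mathrm{Dec}(T)=\mathrm{Dec}(T,|T|)$. $\binom{M}{k}$ denotes the number of $k$-element subsets of $[M]$. -}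

module Defs where

open import Data.Nat using (ℕ; zero; suc) renaming (_+_ to _+ℕ_; _*_ to _*ℕ_)
open import Data.Nat.Combinatorics using (_C_)
open import Data.Integer using (ℤ; +_; -[1+_]; _+_; _-_; _≤_; _<_)
open import Data.List using (List; []; _∷_; _++_; length)
open import Data.List.Relation.Unary.Unique.Propositional using (Unique)
open import Data.List.Membership.Propositional using (_∈_)
open import Data.Product using (_×_)
open import Data.Unit using (⊤)
open import Relation.Binary.PropositionalEquality using (_≡_)

-- Plane binary trees (shapes); `leaf` is a missing child.
data Tree : Set where
  leaf : Tree
  node : Tree → Tree → Tree

size : Tree → ℕ
size leaf = 0
size (node l r) = size l +ℕ suc (size r)

data Lab : Tree → Set where
  lleaf : Lab leaf
  lnode : ∀ {l r} → Lab l → ℤ → Lab r → Lab (node l r)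

flatten : ∀ {T} → Lab T → List ℤ
flatten lleaf = []
flatten (lnode l x r) = flatten l ++ (x ∷ flatten r)

LeftChildGeq : ∀ {T} → ℤ → Lab T → Set
LeftChildGeq x lleaf = ⊤
LeftChildGeq x (lnode _ y _) = x ≤ y

RightChildGt : ∀ {T} → ℤ → Lab T → Set
RightChildGt x lleaf = ⊤
RightChildGt x (lnode _ y _) = x < y

ChildLt : ∀ {T} → ℤ → Lab T → Set
ChildLt x lleaf = ⊤
ChildLt x (lnode _ y _) = y < x

-- Admissible κ for the indexed tree with shape T and support starting at a
-- (nodes canonically labeled a, a+1, ... in inorder).  For the root of a
-- subtree whose inorder labels start at s, ρ_T(root) = s (following left
-- children reaches the leftmost node of the subtree).
KappaOK : ∀ {T} → ℤ → Lab T → Set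
KappaOK s lleaf = ⊤
KappaOK {node l r} s (lnode kl x kr) =
  (+ 1 ≤ x) × (x ≤ s) × LeftChildGeq x kl × RightChildGt x kr
  × KappaOK s kl × KappaOK (s + + (size l) + + 1) kr

DecLabels : ∀ {T} → ℤ → Lab T → Set
DecLabels M lleaf = ⊤
DecLabels M (lnode dl x dr) =
  (+ 1 ≤ x) × (x ≤ M) × ChildLt x dl × ChildLt x dr
  × DecLabels M dl × DecLabels M dr

IsDec : ∀ {T} → ℤ → Lab T → Set
IsDec M d = DecLabels M d × Unique (flatten d)

-- "The set {x | P x} has exactly n elements": witnessed by a duplicate-free
-- list enumerating exactly the elements satisfying P.
record HasCard {A : Set} (P : A → Set) (n : ℕ) : Set where
  field
    elems    : List A
    unique   : Unique elems
    sound    : ∀ {x} → x ∈ elems → P x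
    complete : ∀ {x} → P x → x ∈ elems
    len      : length elems ≡ n

-- Number of k-element subsets of [M] = {i ∈ ℤ | 1 ≤ i ≤ M}.
chooseℤ : ℤ → ℕ → ℕ
chooseℤ (+ m) k = m C k
chooseℤ -[1+ _ ] zero = 1
chooseℤ -[1+ _ ] (suc _) = 0

-- max Supp(T) for the indexed tree with shape T and support [a, a+|T|-1].
maxSupp : Tree → ℤ → ℤ
maxSupp T a = a + + (size T) - + 1

-- Both sides are counted against the hook product h(T) = ∏ᵥ |subtree rooted at v|: with n = |T|
-- and M = a + n - 1, the admissible κ and the decreasing labellings with values in [M] both
-- number M(M-1)⋯(M-n+1) / h(T).  For κ, condition on the root value and sum with the
-- hockey-stick identity for falling factorials.  For decreasing labellings, pass to forests and
-- remove the largest label m+1 of [m+1], which can only sit at the root of one of the trees;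
-- this yields Pascal's rule for falling factorials.  Finally M(M-1)⋯(M-n+1) = C(M,n) · n!, and
-- n!/h(T) = |Dec(T)|.
module Submission where

open import Defs
open import Data.Empty using (⊥-elim)
open import Data.Integer as ℤ using (ℤ; +_; -[1+_]; +≤+; +<+; -<+)
import Data.Integer.Properties as ℤ
import Data.Integer.Tactic.RingSolver as ℤ
open import Data.List using (List; []; _∷_; [_]; _++_; map; length; concatMap; cartesianProductWith; downFrom)
open import Data.List.Membership.DecPropositional ℤ._≟_ using (_∈?_)
open import Data.List.Membership.Propositional using (_∈_; _∉_; find; lose)
open import Data.List.Membership.Propositional.Properties
  using (∈-++⁺ˡ; ∈-++⁺ʳ; ∈-++⁻; ∈-map⁺; ∈-map⁻; ∈-concatMap⁺; ∈-concatMap⁻;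
         ∈-cartesianProductWith⁺; ∈-cartesianProductWith⁻; ∈-downFrom⁺; ∈-downFrom⁻)
open import Data.List.Properties using (length-++; length-map; map-cong; map-∘; ++-assoc; ++-identityʳ)
open import Data.List.Relation.Binary.Permutation.Propositional
  using (_↭_; ↭-sym; ↭-trans; ↭-reflexive; ↭⇒↭ₛ)
open import Data.List.Relation.Binary.Permutation.Propositional.Properties using (shift; ++⁺ˡ; ∈-resp-↭)
import Data.List.Relation.Binary.Permutation.Setoid.Properties as ↭ₛ
open import Data.List.Relation.Unary.All as All using (All; []; _∷_)
open import Data.List.Relation.Unary.All.Properties using (¬Any⇒All¬)
import Data.List.Relation.Unary.AllPairs as AllPairs
open import Data.List.Relation.Unary.Any using (here; there)
open import Data.List.Relation.Unary.Unique.Propositional using (Unique; []; _∷_)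
import Data.List.Relation.Unary.Unique.Propositional.Properties as Unique
open import Data.Nat
open import Data.Nat.Combinatorics using (_C_; nCk+nC[k+1]≡[n+1]C[k+1])
open import Data.Nat.ListAction using (sum; product)
open import Data.Nat.Properties
open import Data.Nat.Tactic.RingSolver using (solve-∀)
open import Data.Product using (Σ; ∃; _×_; _,_; proj₁; proj₂)
open import Data.Sum using (_⊎_; inj₁; inj₂)
open import Data.Unit using (⊤; tt)
open import Function using (_∘_)
open import Relation.Binary.PropositionalEquality
  using (_≡_; refl; sym; trans; cong; cong₂; subst; setoid; module ≡-Reasoning)
open import Relation.Nullary using (¬_; yes; no)
open import Algebra.Properties.CommutativeSemigroup *-commutativeSemigroup using (interchange; x∙yz≈y∙xz)
open import Algebra.Properties.AbelianGroup ℤ.+-0-abelianGroup using () renaming (∙-cancelˡ to ℤ-+-cancelˡ)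
open ≡-Reasoning

-- Falling factorials

infix 8 _↓_ _↓ℤ_

_↓_ : ℕ → ℕ → ℕ
m     ↓ zero  = 1
zero  ↓ suc n = 0
suc m ↓ suc n = suc m * m ↓ n

m<n⇒m↓n≡0 : ∀ {m n} → m < n → m ↓ n ≡ 0
m<n⇒m↓n≡0 {zero}  {suc n} _         = refl
m<n⇒m↓n≡0 {suc m} {suc n} (s≤s m<n) = trans (cong (suc m *_) (m<n⇒m↓n≡0 m<n)) (*-zeroʳ (suc m))

↓-pascal : ∀ m n → suc m ↓ suc n ≡ m ↓ suc n + suc n * m ↓ n
↓-pascal zero    zero    = refl
↓-pascal zero    (suc n) = sym (*-zeroʳ (2+ n))
↓-pascal (suc m) zero    = +-comm 1 (suc m * 1)
↓-pascal (suc m) (suc n) = begin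
  2+ m * (suc m * m ↓ n)
    ≡⟨ regroup (suc m) (m ↓ n) ⟩
  suc m * (suc m * m ↓ n) + suc m * m ↓ n
    ≡⟨ cong (λ x → suc m * x + suc m * m ↓ n) (↓-pascal m n) ⟩
  suc m * (m ↓ suc n + suc n * m ↓ n) + suc m * m ↓ n
    ≡⟨ collect (suc m) (m ↓ suc n) (suc n) (m ↓ n) ⟩
  suc m * m ↓ suc n + 2+ n * (suc m * m ↓ n) ∎
  where
  regroup : ∀ a b → suc a * (a * b) ≡ a * (a * b) + a * b
  regroup = solve-∀
  collect : ∀ a x k y → a * (x + k * y) + a * y ≡ a * x + suc k * (a * y)
  collect = solve-∀

↓-split : ∀ m a b → (b + m) ↓ b * m ↓ a ≡ (b + m) ↓ (b + a)
↓-split m a zero    = +-identityʳ (m ↓ a)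
↓-split m a (suc b) = trans (*-assoc (suc b + m) ((b + m) ↓ b) (m ↓ a)) (cong ((suc b + m) *_) (↓-split m a b))

↓-merge : ∀ m a b → (m + a) ↓ a * (m + a + b) ↓ b ≡ (m + (a + b)) ↓ (a + b)
↓-merge m a b = begin
  (m + a) ↓ a * (m + a + b) ↓ b    ≡⟨ *-comm ((m + a) ↓ a) _ ⟩
  (m + a + b) ↓ b * (m + a) ↓ a    ≡⟨ cong (λ k → k ↓ b * (m + a) ↓ a) (+-comm (m + a) b) ⟩
  (b + (m + a)) ↓ b * (m + a) ↓ a  ≡⟨ ↓-split (m + a) a b ⟩
  (b + (m + a)) ↓ (b + a)          ≡⟨ cong₂ _↓_ (reorder m a b) (+-comm b a) ⟩
  (m + (a + b)) ↓ (a + b)          ∎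
  where
  reorder : ∀ m a b → b + (m + a) ≡ m + (a + b)
  reorder = solve-∀

↓≡C*↓ : ∀ m n → m ↓ n ≡ (m C n) * n ↓ n
↓≡C*↓ m       zero    = refl
↓≡C*↓ zero    (suc n) = refl
↓≡C*↓ (suc m) (suc n) = begin
  suc m ↓ suc n
    ≡⟨ ↓-pascal m n ⟩
  m ↓ suc n + suc n * m ↓ n
    ≡⟨ cong₂ (λ x y → x + suc n * y) (↓≡C*↓ m (suc n)) (↓≡C*↓ m n) ⟩
  (m C suc n) * suc n ↓ suc n + suc n * ((m C n) * n ↓ n)
    ≡⟨ collect (m C suc n) (m C n) (suc n) (n ↓ n) ⟩
  (m C n + m C suc n) * suc n ↓ suc n
    ≡⟨ cong (_* suc n ↓ suc n) (nCk+nC[k+1]≡[n+1]C[k+1] m n) ⟩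
  (suc m C suc n) * suc n ↓ suc n ∎
  where
  collect : ∀ x y k f → x * (k * f) + k * (y * f) ≡ (y + x) * (k * f)
  collect = solve-∀

↓-hockeyStick : ∀ n t → suc n * sum (map (λ i → (i + n) ↓ n) (downFrom t)) ≡ (t + n) ↓ suc n
↓-hockeyStick n zero    = trans (*-zeroʳ (suc n)) (sym (m<n⇒m↓n≡0 (n<1+n n)))
↓-hockeyStick n (suc t) = begin
  suc n * ((t + n) ↓ n + S)              ≡⟨ *-distribˡ-+ (suc n) ((t + n) ↓ n) S ⟩
  suc n * (t + n) ↓ n + suc n * S        ≡⟨ cong (_+_ (suc n * (t + n) ↓ n)) (↓-hockeyStick n t) ⟩
  suc n * (t + n) ↓ n + (t + n) ↓ suc n  ≡⟨ +-comm (suc n * (t + n) ↓ n) ((t + n) ↓ suc n) ⟩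
  (t + n) ↓ suc n + suc n * (t + n) ↓ n  ≡⟨ ↓-pascal (t + n) n ⟨
  suc (t + n) ↓ suc n                    ∎
  where S = sum (map (λ i → (i + n) ↓ n) (downFrom t))

-- Extended to negative arguments in the same way as chooseℤ.
_↓ℤ_ : ℤ → ℕ → ℕ
(+ m)    ↓ℤ n     = m ↓ n
-[1+ _ ] ↓ℤ zero  = 1
-[1+ _ ] ↓ℤ suc _ = 0

chooseℤ*↓≡↓ℤ : ∀ M n → chooseℤ M n * n ↓ n ≡ M ↓ℤ n
chooseℤ*↓≡↓ℤ (+ m)    n       = sym (↓≡C*↓ m n)
chooseℤ*↓≡↓ℤ -[1+ _ ] zero    = refl
chooseℤ*↓≡↓ℤ -[1+ _ ] (suc n) = refl

M<n⇒M↓ℤn≡0 : ∀ {M n} → 0 < n → M ℤ.< + n → M ↓ℤ n ≡ 0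
M<n⇒M↓ℤn≡0 {+ m}                _ (+<+ m<n) = m<n⇒m↓n≡0 m<n
M<n⇒M↓ℤn≡0 { -[1+ _ ]} {suc n} _ _         = refl

module _ {A B : Set} where

  length-concatMap : ∀ (f : A → List B) xs → length (concatMap f xs) ≡ sum (map (length ∘ f) xs)
  length-concatMap f []       = refl
  length-concatMap f (x ∷ xs) = trans (length-++ (f x)) (cong (_+_ (length (f x))) (length-concatMap f xs))

  concatMap⁺ : ∀ {f : A → List B} {xs} → Unique xs → (∀ x → Unique (f x)) →
               (∀ {x x′ y} → y ∈ f x → y ∈ f x′ → x ≡ x′) → Unique (concatMap f xs)
  concatMap⁺ {xs = []}     []         _  _    = []
  concatMap⁺ {f} {x ∷ xs} u@(_ ∷ u′) uf disj =
    Unique.++⁺ (uf x) (concatMap⁺ u′ uf disj) λ (y∈fx , y∈rest) →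
      let x′ , x′∈xs , y∈fx′ = find (∈-concatMap⁻ f {xs} y∈rest)
      in Unique.Unique[x∷xs]⇒x∉xs u (subst (_∈ xs) (disj y∈fx′ y∈fx) x′∈xs)

length-cartesianProductWith : ∀ {A B C : Set} (f : A → B → C) xs ys →
  length (cartesianProductWith f xs ys) ≡ length xs * length ys
length-cartesianProductWith f []       ys = refl
length-cartesianProductWith f (x ∷ xs) ys = begin
  length (map (f x) ys ++ cartesianProductWith f xs ys)
    ≡⟨ length-++ (map (f x) ys) ⟩
  length (map (f x) ys) + length (cartesianProductWith f xs ys)
    ≡⟨ cong₂ _+_ (length-map (f x) ys) (length-cartesianProductWith f xs ys) ⟩
  length ys + length xs * length ys ∎

sum-map-*ʳ : ∀ {A : Set} (f : A → ℕ) c xs → sum (map (λ x → f x * c) xs) ≡ sum (map f xs) * c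
sum-map-*ʳ f c []       = refl
sum-map-*ʳ f c (x ∷ xs) = trans (cong (_+_ (f x * c)) (sum-map-*ʳ f c xs)) (sym (*-distribʳ-+ c (f x) _))

Unique-resp-↭ : ∀ {A : Set} {xs ys : List A} → xs ↭ ys → Unique xs → Unique ys
Unique-resp-↭ xs↭ys = ↭ₛ.Unique-resp-↭ (setoid _) (↭⇒↭ₛ xs↭ys)

hookProduct : Tree → ℕ
hookProduct leaf       = 1
hookProduct (node l r) = size (node l r) * (hookProduct l * hookProduct r)

hookProduct-nonZero : ∀ T → NonZero (hookProduct T)
hookProduct-nonZero leaf       = _
hookProduct-nonZero (node l r) =
  m*n≢0 (size (node l r)) _ {{≢-nonZero (m+1+n≢0 (size l))}}
        {{m*n≢0 _ _ {{hookProduct-nonZero l}} {{hookProduct-nonZero r}}}}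

-- Admissible κ

-- kappas T s t lists the κ with KappaOK s whose root value is one of s, s-1, …, s-t+1
-- (RightChildGt y d says that y lies below the root value of d).  In the slice with root
-- value s - i, the right subtree takes its values among the i + |l| + 1 integers of
-- (s - i, s + |l| + 1].
kappas : (T : Tree) → ℤ → ℕ → List (Lab T)
kappaSlice : (l r : Tree) → ℤ → ℕ → List (Lab (node l r))

kappas leaf       s t = [ lleaf ]
kappas (node l r) s t = concatMap (kappaSlice l r s) (downFrom t)

kappaSlice l r s i =
  cartesianProductWith (λ a b → lnode a (s ℤ.- + i) b)
    (kappas l s (suc i)) (kappas r (s ℤ.+ + size l ℤ.+ + 1) (suc (i + size l)))

rootValue : ∀ {l r} → Lab (node l r) → ℤ
rootValue (lnode _ x _) = x

∈-kappaSlice⇒rootValue : ∀ {l r s i d} → d ∈ kappaSlice l r s i → rootValue d ≡ s ℤ.- + i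
∈-kappaSlice⇒rootValue {l} {r} {s} {i} d∈
  with _ , _ , _ , _ , refl
         ← ∈-cartesianProductWith⁻ (λ a b → lnode a (s ℤ.- + i) b) (kappas l s (suc i)) _ d∈
  = refl

i<t⇒s-t<s-i : ∀ s {i t} → i < t → s ℤ.- + t ℤ.< s ℤ.- + i
i<t⇒s-t<s-i s i<t = ℤ.+-monoʳ-< s (ℤ.neg-mono-< (+<+ i<t))

s-t<x≤s⇒x≡s-i : ∀ {s x} t → s ℤ.- + t ℤ.< x → x ℤ.≤ s → ∃ λ i → i < t × x ≡ s ℤ.- + i
s-t<x≤s⇒x≡s-i {s} {x} t s-t<x x≤s = i , i<t , sym s-i≡x
  where
  i = ℤ.∣ x ℤ.- s ∣
  s-[s-x]≡x : ∀ s x → s ℤ.- (s ℤ.- x) ≡ x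
  s-[s-x]≡x = ℤ.solve-∀
  s-i≡x : s ℤ.- + i ≡ x
  s-i≡x = trans (cong (ℤ._-_ s) (ℤ.∣-∣-≤ x≤s)) (s-[s-x]≡x s x)
  i<t : i < t
  i<t with t ≤? i
  ... | yes t≤i = ⊥-elim (ℤ.≤⇒≯ (subst (ℤ._≤ s ℤ.- + t) s-i≡x s-i≤s-t) s-t<x)
    where s-i≤s-t = ℤ.+-monoʳ-≤ s (ℤ.neg-mono-≤ (+≤+ t≤i))
  ... | no  t≰i = ≰⇒> t≰i

RightChildGt⇒LeftChildGeq : ∀ {T x y} → ℤ.suc y ≡ x → (d : Lab T) → RightChildGt y d → LeftChildGeq x d
RightChildGt⇒LeftChildGeq e lleaf         _   = tt
RightChildGt⇒LeftChildGeq e (lnode _ _ _) y<z = subst (ℤ._≤ _) e (ℤ.i<j⇒suc[i]≤j y<z)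

LeftChildGeq⇒RightChildGt : ∀ {T x y} → ℤ.suc y ≡ x → (d : Lab T) → LeftChildGeq x d → RightChildGt y d
LeftChildGeq⇒RightChildGt e lleaf         _   = tt
LeftChildGeq⇒RightChildGt e (lnode _ _ _) x≤z = ℤ.suc[i]≤j⇒i<j (subst (ℤ._≤ _) (sym e) x≤z)

private
  left-bound : ∀ s i → ℤ.suc (s ℤ.- + suc i) ≡ s ℤ.- + i
  left-bound s i = rearrange s (+ i)
    where
    rearrange : ∀ s i → + 1 ℤ.+ (s ℤ.- (+ 1 ℤ.+ i)) ≡ s ℤ.- i
    rearrange = ℤ.solve-∀

  right-bound : ∀ s i L → (s ℤ.+ + L ℤ.+ + 1) ℤ.- + suc (i + L) ≡ s ℤ.- + i
  right-bound s i L = rearrange s (+ i) (+ L)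
    where
    rearrange : ∀ s i L → s ℤ.+ L ℤ.+ + 1 ℤ.- (+ 1 ℤ.+ (i ℤ.+ L)) ≡ s ℤ.- i
    rearrange = ℤ.solve-∀

  1≤s-i : ∀ {s} i → + suc i ℤ.≤ s → + 1 ℤ.≤ s ℤ.- + i
  1≤s-i {s} i 1+i≤s = subst (ℤ._≤ s ℤ.- + i) (1+i-i≡1 (+ i)) (ℤ.+-monoˡ-≤ (ℤ.- + i) 1+i≤s)
    where
    1+i-i≡1 : ∀ i → (+ 1 ℤ.+ i) ℤ.- i ≡ + 1
    1+i-i≡1 = ℤ.solve-∀

  1+i+L≤s+L+1 : ∀ {s} i L → + suc i ℤ.≤ s → + suc (i + L) ℤ.≤ s ℤ.+ + L ℤ.+ + 1
  1+i+L≤s+L+1 i L 1+i≤s =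
    ℤ.≤-trans (+≤+ (m≤m+n (suc (i + L)) 1)) (ℤ.+-monoˡ-≤ (+ 1) (ℤ.+-monoˡ-≤ (+ L) 1+i≤s))

kappas-sound : ∀ T s t {d} → + t ℤ.≤ s → d ∈ kappas T s t → KappaOK s d × RightChildGt (s ℤ.- + t) d
kappas-sound leaf       s t t≤s (here refl) = tt , tt
kappas-sound (node l r) s t t≤s d∈
  with i , i∈ , d∈slice ← find (∈-concatMap⁻ (kappaSlice l r s) {downFrom t} d∈)
  with a , b , a∈ , b∈ , refl
         ← ∈-cartesianProductWith⁻ (λ a b → lnode a (s ℤ.- + i) b) (kappas l s (suc i)) _ d∈slice
  with i<t ← ∈-downFrom⁻ i∈
  with 1+i≤s ← ℤ.≤-trans (+≤+ i<t) t≤s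
  with κa , a> ← kappas-sound l s (suc i) 1+i≤s a∈
  with κb , b> ← kappas-sound r _ (suc (i + size l)) (1+i+L≤s+L+1 i (size l) 1+i≤s) b∈
  = ( 1≤s-i i 1+i≤s , ℤ.i-j≤i s (+ i)
    , RightChildGt⇒LeftChildGeq (left-bound s i) a a>
    , subst (λ y → RightChildGt y b) (right-bound s i (size l)) b>
    , κa , κb )
  , i<t⇒s-t<s-i s i<t

kappas-complete : ∀ T s t (d : Lab T) → KappaOK s d → RightChildGt (s ℤ.- + t) d → d ∈ kappas T s t
kappas-complete leaf       s t lleaf _ _ = here refl
kappas-complete (node l r) s t (lnode a x b) (_ , x≤s , x≤a , x<b , κa , κb) s-t<x
  with i , i<t , refl ← s-t<x≤s⇒x≡s-i t s-t<x x≤s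
  = ∈-concatMap⁺ (kappaSlice l r s)
      (lose (∈-downFrom⁺ i<t) (∈-cartesianProductWith⁺ (λ a b → lnode a (s ℤ.- + i) b) a∈ b∈))
  where
  a∈ = kappas-complete l s (suc i) a κa (LeftChildGeq⇒RightChildGt (left-bound s i) a x≤a)
  b∈ = kappas-complete r _ (suc (i + size l)) b κb
         (subst (λ y → RightChildGt y b) (sym (right-bound s i (size l))) x<b)

kappas-unique : ∀ T s t → Unique (kappas T s t)
kappas-unique leaf       s t = [] ∷ []
kappas-unique (node l r) s t = concatMap⁺ (Unique.downFrom⁺ t) slice-unique disjoint
  where
  slice-unique : ∀ i → Unique (kappaSlice l r s i)
  slice-unique i = Unique.cartesianProductWith⁺ _ (λ { refl → refl , refl })
    (kappas-unique l s (suc i)) (kappas-unique r _ (suc (i + size l)))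
  disjoint : ∀ {i j d} → d ∈ kappaSlice l r s i → d ∈ kappaSlice l r s j → i ≡ j
  disjoint d∈i d∈j = ℤ.+-injective (ℤ.neg-injective
    (ℤ-+-cancelˡ s _ _ (trans (sym (∈-kappaSlice⇒rootValue d∈i)) (∈-kappaSlice⇒rootValue d∈j))))

kappas-count : ∀ T s t → length (kappas T s t) * hookProduct T ≡ (t + size T ∸ 1) ↓ size T
kappas-count leaf       s t = refl
kappas-count (node l r) s t = begin
  length K * (n * H)   ≡⟨ x∙yz≈y∙xz (length K) n H ⟩
  n * (length K * H)   ≡⟨ cong (n *_) slices-count ⟩
  n * S                ≡⟨ cong (_* S) (+-suc L R) ⟩
  suc N * S            ≡⟨ ↓-hockeyStick N t ⟩
  (t + N) ↓ suc N      ≡⟨ cong₂ _↓_ (cong (_∸ 1) (+-suc t N)) (+-suc L R) ⟨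
  (t + suc N ∸ 1) ↓ n  ≡⟨ cong (λ k → (t + k ∸ 1) ↓ n) (+-suc L R) ⟨
  (t + n ∸ 1) ↓ n      ∎
  where
  L = size l
  R = size r
  N = L + R
  n = size (node l r)
  H = hookProduct l * hookProduct r
  K = kappas (node l r) s t
  S = sum (map (λ i → (i + N) ↓ N) (downFrom t))
  slice-count : ∀ i → length (kappaSlice l r s i) * H ≡ (i + N) ↓ N
  slice-count i = begin
    length (kappaSlice l r s i) * H
      ≡⟨ cong (_* H) (length-cartesianProductWith _ A B) ⟩
    length A * length B * (hookProduct l * hookProduct r)
      ≡⟨ interchange (length A) (length B) _ _ ⟩
    length A * hookProduct l * (length B * hookProduct r)
      ≡⟨ cong₂ _*_ (kappas-count l s (suc i)) (kappas-count r _ (suc (i + L))) ⟩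
    (i + L) ↓ L * (i + L + R) ↓ R
      ≡⟨ ↓-merge i L R ⟩
    (i + N) ↓ N ∎
    where
    A = kappas l s (suc i)
    B = kappas r (s ℤ.+ + L ℤ.+ + 1) (suc (i + L))
  slices-count : length K * H ≡ S
  slices-count = begin
    length K * H
      ≡⟨ cong (_* H) (length-concatMap (kappaSlice l r s) (downFrom t)) ⟩
    sum (map (length ∘ kappaSlice l r s) (downFrom t)) * H
      ≡⟨ sum-map-*ʳ (length ∘ kappaSlice l r s) H (downFrom t) ⟨
    sum (map (λ i → length (kappaSlice l r s i) * H) (downFrom t))
      ≡⟨ cong sum (map-cong slice-count (downFrom t)) ⟩
    S ∎

maxSupp-nonNeg : ∀ T a → 0 < size T → maxSupp T (+ a) ≡ + (a + size T ∸ 1)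
maxSupp-nonNeg T a 0<n = go (size T) 0<n
  where
  go : ∀ n → 0 < n → + a ℤ.+ + n ℤ.- + 1 ≡ + (a + n ∸ 1)
  go (suc n) _ = trans (rearrange (+ a) (+ n)) (cong (λ k → + (k ∸ 1)) (sym (+-suc a n)))
    where
    rearrange : ∀ x y → x ℤ.+ (+ 1 ℤ.+ y) ℤ.- + 1 ≡ x ℤ.+ y
    rearrange = ℤ.solve-∀

maxSupp-neg< : ∀ T k → maxSupp T -[1+ k ] ℤ.< + size T
maxSupp-neg< T k = ℤ.≤-<-trans (ℤ.i-j≤i _ (+ 1)) (ℤ.+-monoˡ-< (+ size T) -<+)

KappaOK⇒0<root : ∀ {T} s (d : Lab T) → KappaOK s d → RightChildGt (+ 0) d
KappaOK⇒0<root s lleaf         _         = tt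
KappaOK⇒0<root s (lnode _ _ _) (1≤x , _) = ℤ.suc[i]≤j⇒i<j 1≤x

kappaCard : ∀ T a → 0 < size T →
  Σ ℕ λ k → HasCard (KappaOK {T} a) k × k * hookProduct T ≡ maxSupp T a ↓ℤ size T
kappaCard T (+ a) 0<n = length (kappas T (+ a) a) , card , count
  where
  card : HasCard (KappaOK {T} (+ a)) (length (kappas T (+ a) a))
  card = record
    { elems    = kappas T (+ a) a
    ; unique   = kappas-unique T (+ a) a
    ; sound    = λ d∈ → proj₁ (kappas-sound T (+ a) a ℤ.≤-refl d∈)
    ; complete = λ {d} κ → kappas-complete T (+ a) a d κ
                   (subst (λ y → RightChildGt y d) (sym (ℤ.+-inverseʳ (+ a))) (KappaOK⇒0<root (+ a) d κ))
    ; len      = refl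
    }
  count = trans (kappas-count T (+ a) a) (cong (_↓ℤ size T) (sym (maxSupp-nonNeg T a 0<n)))
kappaCard (node l r) -[1+ k ] 0<n = 0 , card , sym (M<n⇒M↓ℤn≡0 0<n (maxSupp-neg< (node l r) k))
  where
  card : HasCard (KappaOK {node l r} -[1+ k ]) 0
  card = record
    { elems    = []
    ; unique   = []
    ; sound    = λ ()
    ; complete = λ { {lnode _ _ _} (1≤x , x≤a , _) → ⊥-elim (ℤ.≤⇒≯ (ℤ.≤-trans 1≤x x≤a) -<+) }
    ; len      = refl
    }

-- Decreasing labellings of forests

1+m≰m : ∀ m → + suc m ℤ.≰ + m
1+m≰m m (+≤+ 1+m≤m) = 1+n≰n 1+m≤m

∈-flatten-lnode : ∀ {l r z x} (a : Lab l) (b : Lab r) → z ∈ flatten (lnode a x b) →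
                  z ∈ flatten a ⊎ z ≡ x ⊎ z ∈ flatten b
∈-flatten-lnode a b z∈ with ∈-++⁻ (flatten a) z∈
... | inj₁ z∈a         = inj₁ z∈a
... | inj₂ (here z≡x)  = inj₂ (inj₁ z≡x)
... | inj₂ (there z∈b) = inj₂ (inj₂ z∈b)

DecLabels-mono : ∀ {T m m′} → m ℤ.≤ m′ → (d : Lab T) → DecLabels m d → DecLabels m′ d
DecLabels-mono m≤m′ lleaf         _                                  = tt
DecLabels-mono m≤m′ (lnode a x b) (1≤x , x≤m , a<x , b<x , da , db) =
  1≤x , ℤ.≤-trans x≤m m≤m′ , a<x , b<x , DecLabels-mono m≤m′ a da , DecLabels-mono m≤m′ b db

DecLabels-below : ∀ {T m y z} (d : Lab T) → DecLabels m d → ChildLt y d → z ∈ flatten d → z ℤ.< y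
DecLabels-below lleaf _ _ ()
DecLabels-below (lnode a x b) (_ , _ , a<x , b<x , da , db) x<y z∈ with ∈-flatten-lnode a b z∈
... | inj₁ z∈a         = ℤ.<-trans (DecLabels-below a da a<x z∈a) x<y
... | inj₂ (inj₁ refl) = x<y
... | inj₂ (inj₂ z∈b)  = ℤ.<-trans (DecLabels-below b db b<x z∈b) x<y

DecLabels-≤root : ∀ {l r m x z} (a : Lab l) (b : Lab r) →
                  DecLabels m (lnode a x b) → z ∈ flatten (lnode a x b) → z ℤ.≤ x
DecLabels-≤root a b (_ , _ , a<x , b<x , da , db) z∈ with ∈-flatten-lnode a b z∈
... | inj₁ z∈a         = ℤ.<⇒≤ (DecLabels-below a da a<x z∈a)
... | inj₂ (inj₁ refl) = ℤ.≤-refl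
... | inj₂ (inj₂ z∈b)  = ℤ.<⇒≤ (DecLabels-below b db b<x z∈b)

DecLabels-bounded : ∀ {T m z} (d : Lab T) → DecLabels m d → z ∈ flatten d → z ℤ.≤ m
DecLabels-bounded lleaf _ ()
DecLabels-bounded (lnode a x b) dd z∈ = ℤ.≤-trans (DecLabels-≤root a b dd z∈) (proj₁ (proj₂ dd))

DecLabels-lower : ∀ {T} m (d : Lab T) → DecLabels (+ suc m) d → + suc m ∉ flatten d → DecLabels (+ m) d
DecLabels-lower m lleaf         _                                   _  = tt
DecLabels-lower m (lnode a x b) (1≤x , x≤1+m , a<x , b<x , da , db) m∉ =
  1≤x , x≤m , a<x , b<x ,
  DecLabels-lower m a da (m∉ ∘ ∈-++⁺ˡ) , DecLabels-lower m b db (m∉ ∘ ∈-++⁺ʳ (flatten a) ∘ there)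
  where
  x≤m : x ℤ.≤ + m
  x≤m = ℤ.i<j⇒i≤pred[j] (ℤ.≤∧≢⇒< x≤1+m (λ x≡ → m∉ (∈-++⁺ʳ (flatten a) (here (sym x≡)))))

DecLabels⇒ChildLt : ∀ {T} m (d : Lab T) → DecLabels (+ m) d → ChildLt (+ suc m) d
DecLabels⇒ChildLt m lleaf         _              = tt
DecLabels⇒ChildLt m (lnode _ _ _) (_ , x≤m , _) = ℤ.≤-<-trans x≤m (+<+ (n<1+n m))

sizes : List Tree → ℕ
sizes F = sum (map size F)

hookProducts : List Tree → ℕ
hookProducts F = product (map hookProduct F)

data Pick : List Tree → Set where
  pick : ∀ {l r F} → Pick (node l r ∷ F)
  skip : ∀ {T F} → Pick F → Pick (T ∷ F)

deleteRoot : ∀ {F} → Pick F → List Tree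
deleteRoot (pick {l} {r} {F}) = l ∷ r ∷ F
deleteRoot (skip {T} p)       = T ∷ deleteRoot p

pickedSize : ∀ {F} → Pick F → ℕ
pickedSize (pick {l} {r}) = size (node l r)
pickedSize (skip p)       = pickedSize p

picks : (F : List Tree) → List (Pick F)
picks []             = []
picks (leaf ∷ F)     = map skip (picks F)
picks (node l r ∷ F) = pick ∷ map skip (picks F)

∈-picks : ∀ {F} (p : Pick F) → p ∈ picks F
∈-picks {node l r ∷ F} pick     = here refl
∈-picks {leaf ∷ F}     (skip p) = ∈-map⁺ skip (∈-picks p)
∈-picks {node l r ∷ F} (skip p) = there (∈-map⁺ skip (∈-picks p))

skip-injective : ∀ {T F} {p q : Pick F} → skip {T} p ≡ skip q → p ≡ q
skip-injective refl = refl

picks-unique : ∀ F → Unique (picks F)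
picks-unique []             = []
picks-unique (leaf ∷ F)     = Unique.map⁺ skip-injective (picks-unique F)
picks-unique (node l r ∷ F) = ¬Any⇒All¬ _ pick∉ ∷ Unique.map⁺ skip-injective (picks-unique F)
  where
  pick∉ : pick ∉ map skip (picks F)
  pick∉ p∈ with _ , _ , () ← ∈-map⁻ skip p∈

sum-pickedSize : ∀ F → sum (map pickedSize (picks F)) ≡ sizes F
sum-pickedSize []             = refl
sum-pickedSize (leaf ∷ F)     = trans (cong sum (sym (map-∘ (picks F)))) (sum-pickedSize F)
sum-pickedSize (node l r ∷ F) =
  cong (_+_ (size (node l r))) (trans (cong sum (sym (map-∘ (picks F)))) (sum-pickedSize F))

sizes-deleteRoot : ∀ {F} (p : Pick F) → sizes F ≡ suc (sizes (deleteRoot p))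
sizes-deleteRoot {node l r ∷ F} pick = regroup (size l) (size r) (sizes F)
  where
  regroup : ∀ a b c → a + suc b + c ≡ suc (a + (b + c))
  regroup = solve-∀
sizes-deleteRoot {T ∷ F} (skip p) = trans (cong (_+_ (size T)) (sizes-deleteRoot p)) (+-suc (size T) _)

hookProducts-deleteRoot : ∀ {F} (p : Pick F) → hookProducts F ≡ pickedSize p * hookProducts (deleteRoot p)
hookProducts-deleteRoot {node l r ∷ F} pick =
  regroup (size (node l r)) (hookProduct l) (hookProduct r) (hookProducts F)
  where
  regroup : ∀ n a b c → n * (a * b) * c ≡ n * (a * (b * c))
  regroup = solve-∀
hookProducts-deleteRoot {T ∷ F} (skip p) =
  trans (cong (hookProduct T *_) (hookProducts-deleteRoot p)) (x∙yz≈y∙xz (hookProduct T) (pickedSize p) _)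

graft : ∀ {F} (p : Pick F) → ℤ → All Lab (deleteRoot p) → All Lab F
graft pick     x (a ∷ b ∷ g) = lnode a x b ∷ g
graft (skip p) x (t ∷ g)     = t ∷ graft p x g

prune : ∀ {F} (p : Pick F) → All Lab F → All Lab (deleteRoot p)
prune pick     (lnode a _ b ∷ g) = a ∷ b ∷ g
prune (skip p) (t ∷ g)           = t ∷ prune p g

pickedRoot : ∀ {F} → Pick F → All Lab F → ℤ
pickedRoot pick     (lnode _ x _ ∷ _) = x
pickedRoot (skip p) (_ ∷ g)           = pickedRoot p g

prune-graft : ∀ {F} (p : Pick F) x g → prune p (graft p x g) ≡ g
prune-graft pick     x (a ∷ b ∷ g) = refl
prune-graft (skip p) x (t ∷ g)     = cong (t ∷_) (prune-graft p x g)

graft-prune : ∀ {F} (p : Pick F) g → graft p (pickedRoot p g) (prune p g) ≡ g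
graft-prune pick     (lnode a x b ∷ g) = refl
graft-prune (skip p) (t ∷ g)           = cong (t ∷_) (graft-prune p g)

graft-injective : ∀ {F} (p : Pick F) x {g g′} → graft p x g ≡ graft p x g′ → g ≡ g′
graft-injective p x {g} {g′} e = trans (sym (prune-graft p x g)) (trans (cong (prune p) e) (prune-graft p x g′))

flattenAll : ∀ {F} → All Lab F → List ℤ
flattenAll []      = []
flattenAll (t ∷ g) = flatten t ++ flattenAll g

flattenAll-graft : ∀ {F} (p : Pick F) x g → flattenAll (graft p x g) ↭ x ∷ flattenAll g
flattenAll-graft pick     x (a ∷ b ∷ g) =
  ↭-trans (↭-reflexive (++-assoc (flatten a) (x ∷ flatten b) (flattenAll g))) (shift x (flatten a) _)
flattenAll-graft (skip p) x (t ∷ g)     =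
  ↭-trans (++⁺ˡ (flatten t) (flattenAll-graft p x g)) (shift x (flatten t) (flattenAll g))

flattenAll-prune : ∀ {F} (p : Pick F) g → flattenAll g ↭ pickedRoot p g ∷ flattenAll (prune p g)
flattenAll-prune p g =
  subst (λ h → flattenAll h ↭ pickedRoot p g ∷ flattenAll (prune p g))
        (graft-prune p g) (flattenAll-graft p _ (prune p g))

AllDecLabels : ∀ {F} → ℤ → All Lab F → Set
AllDecLabels m []      = ⊤
AllDecLabels m (t ∷ g) = DecLabels m t × AllDecLabels m g

IsDecForest : ∀ {F} → ℤ → All Lab F → Set
IsDecForest m g = AllDecLabels m g × Unique (flattenAll g)

AllDecLabels-mono : ∀ {F m m′} → m ℤ.≤ m′ → (g : All Lab F) → AllDecLabels m g → AllDecLabels m′ g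
AllDecLabels-mono m≤m′ []      _         = tt
AllDecLabels-mono m≤m′ (t ∷ g) (dt , dg) = DecLabels-mono m≤m′ t dt , AllDecLabels-mono m≤m′ g dg

AllDecLabels-bounded : ∀ {F m z} (g : All Lab F) → AllDecLabels m g → z ∈ flattenAll g → z ℤ.≤ m
AllDecLabels-bounded (t ∷ g) (dt , dg) z∈ with ∈-++⁻ (flatten t) z∈
... | inj₁ z∈t = DecLabels-bounded t dt z∈t
... | inj₂ z∈g = AllDecLabels-bounded g dg z∈g

AllDecLabels-lower : ∀ {F} m (g : All Lab F) →
                     AllDecLabels (+ suc m) g → + suc m ∉ flattenAll g → AllDecLabels (+ m) g
AllDecLabels-lower m []      _         _  = tt
AllDecLabels-lower m (t ∷ g) (dt , dg) m∉ =
  DecLabels-lower m t dt (m∉ ∘ ∈-++⁺ˡ) , AllDecLabels-lower m g dg (m∉ ∘ ∈-++⁺ʳ (flatten t))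

prune-AllDecLabels : ∀ {F M} (p : Pick F) g → AllDecLabels M g → AllDecLabels M (prune p g)
prune-AllDecLabels pick     (lnode a x b ∷ g) ((_ , _ , _ , _ , da , db) , dg) = da , db , dg
prune-AllDecLabels (skip p) (t ∷ g)           (dt , dg)                         = dt , prune-AllDecLabels p g dg

graft-AllDecLabels : ∀ {F} m (p : Pick F) g →
                     AllDecLabels (+ m) g → AllDecLabels (+ suc m) (graft p (+ suc m) g)
graft-AllDecLabels m pick (a ∷ b ∷ g) (da , db , dg) =
  (+≤+ (s≤s z≤n) , ℤ.≤-refl , DecLabels⇒ChildLt m a da , DecLabels⇒ChildLt m b db ,
   DecLabels-mono m≤1+m a da , DecLabels-mono m≤1+m b db) , AllDecLabels-mono m≤1+m g dg
  where m≤1+m = +≤+ (n≤1+n m)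
graft-AllDecLabels m (skip p) (t ∷ g) (dt , dg) =
  DecLabels-mono (+≤+ (n≤1+n m)) t dt , graft-AllDecLabels m p g dg

pickedRoot-max : ∀ {F} m (g : All Lab F) → AllDecLabels (+ suc m) g → + suc m ∈ flattenAll g →
  ∃ λ (p : Pick F) → pickedRoot p g ≡ + suc m
pickedRoot-max m (lleaf ∷ g) (_ , dg) m∈ = let p , e = pickedRoot-max m g dg m∈ in skip p , e
pickedRoot-max m (lnode a x b ∷ g) (dt , dg) m∈ with ∈-++⁻ (flatten (lnode a x b)) m∈
... | inj₁ m∈t = pick , ℤ.≤-antisym (proj₁ (proj₂ dt)) (DecLabels-≤root a b dt m∈t)
... | inj₂ m∈g = let p , e = pickedRoot-max m g dg m∈g in skip p , e

graft-IsDecForest : ∀ {F} m (p : Pick F) g →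
                    IsDecForest (+ m) g → IsDecForest (+ suc m) (graft p (+ suc m) g)
graft-IsDecForest m p g (dg , ug) =
  graft-AllDecLabels m p g dg ,
  Unique-resp-↭ (↭-sym (flattenAll-graft p _ g)) (¬Any⇒All¬ _ (1+m≰m m ∘ AllDecLabels-bounded g dg) ∷ ug)

prune-IsDecForest : ∀ {F} m (p : Pick F) g →
                    IsDecForest (+ suc m) g → pickedRoot p g ≡ + suc m → IsDecForest (+ m) (prune p g)
prune-IsDecForest m p g (dg , ug) root≡ =
  AllDecLabels-lower m (prune p g) (prune-AllDecLabels p g dg)
    (subst (_∉ flattenAll (prune p g)) root≡ (Unique.Unique[x∷xs]⇒x∉xs u)) ,
  AllPairs.tail u
  where
  u : Unique (pickedRoot p g ∷ flattenAll (prune p g))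
  u = Unique-resp-↭ (flattenAll-prune p g) ug

graft-pick-injective : ∀ {F} m (p q : Pick F) {g h} → AllDecLabels (+ m) g → AllDecLabels (+ m) h →
  graft p (+ suc m) g ≡ graft q (+ suc m) h → p ≡ q
graft-pick-injective m pick     pick     _         _         _ = refl
graft-pick-injective m pick     (skip q) {a ∷ b ∷ g} {t ∷ h} _ (dt , _) e =
  ⊥-elim (1+m≰m m (proj₁ (proj₂ (subst (DecLabels (+ m)) (sym (cong All.head e)) dt))))
graft-pick-injective m (skip p) pick     {t ∷ g} {a ∷ b ∷ h} (dt , _) _ e =
  ⊥-elim (1+m≰m m (proj₁ (proj₂ (subst (DecLabels (+ m)) (cong All.head e) dt))))
graft-pick-injective m (skip p) (skip q) {_ ∷ g} {_ ∷ h} (_ , dg) (_ , dh) e =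
  cong skip (graft-pick-injective m p q dg dh (cong All.tail e))

leafLabellings : (F : List Tree) → List (All Lab F)
leafLabellings []             = [] ∷ []
leafLabellings (leaf ∷ F)     = map (lleaf ∷_) (leafLabellings F)
leafLabellings (node _ _ ∷ F) = []

decForests : ℕ → (F : List Tree) → List (All Lab F)
grafts : ℕ → (F : List Tree) → Pick F → List (All Lab F)

decForests zero    F = leafLabellings F
decForests (suc m) F = decForests m F ++ concatMap (grafts m F) (picks F)

grafts m F p = map (graft p (+ suc m)) (decForests m (deleteRoot p))

leafLabellings-sound : ∀ F {g} → g ∈ leafLabellings F → IsDecForest (+ 0) g
leafLabellings-sound []         (here refl) = tt , []
leafLabellings-sound (leaf ∷ F) g∈ with g′ , g′∈ , refl ← ∈-map⁻ (lleaf ∷_) g∈ =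
  let dg , ug = leafLabellings-sound F g′∈ in (tt , dg) , ug

decForests-sound : ∀ m F {g} → g ∈ decForests m F → IsDecForest (+ m) g
decForests-sound zero    F g∈ = leafLabellings-sound F g∈
decForests-sound (suc m) F {g} g∈ with ∈-++⁻ (decForests m F) g∈
... | inj₁ g∈old = let dg , ug = decForests-sound m F g∈old in AllDecLabels-mono (+≤+ (n≤1+n m)) g dg , ug
... | inj₂ g∈new
  with p , _ , g∈p ← find (∈-concatMap⁻ (grafts m F) {picks F} g∈new)
  with h , h∈ , refl ← ∈-map⁻ (graft p (+ suc m)) g∈p
  = graft-IsDecForest m p h (decForests-sound m (deleteRoot p) h∈)

leafLabellings-complete : ∀ {F} (g : All Lab F) → AllDecLabels (+ 0) g → g ∈ leafLabellings F
leafLabellings-complete []                _                     = here refl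
leafLabellings-complete (lleaf ∷ g)       (_ , dg)              = ∈-map⁺ (lleaf ∷_) (leafLabellings-complete g dg)
leafLabellings-complete (lnode _ _ _ ∷ g) ((1≤x , x≤0 , _) , _) = ⊥-elim (1+m≰m 0 (ℤ.≤-trans 1≤x x≤0))

decForests-complete : ∀ m F (g : All Lab F) → IsDecForest (+ m) g → g ∈ decForests m F
decForests-complete zero    F g (dg , _)  = leafLabellings-complete g dg
decForests-complete (suc m) F g (dg , ug) with + suc m ∈? flattenAll g
... | no m∉ = ∈-++⁺ˡ (decForests-complete m F g (AllDecLabels-lower m g dg m∉ , ug))
... | yes m∈ with p , root≡ ← pickedRoot-max m g dg m∈ =
  ∈-++⁺ʳ (decForests m F)
    (∈-concatMap⁺ (grafts m F) (lose (∈-picks p) (subst (_∈ grafts m F p) regraft pruned∈)))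
  where
  pruned∈ : graft p (+ suc m) (prune p g) ∈ grafts m F p
  pruned∈ = ∈-map⁺ (graft p (+ suc m))
    (decForests-complete m (deleteRoot p) (prune p g) (prune-IsDecForest m p g (dg , ug) root≡))
  regraft : graft p (+ suc m) (prune p g) ≡ g
  regraft = trans (cong (λ x → graft p x (prune p g)) (sym root≡)) (graft-prune p g)

leafLabellings-unique : ∀ F → Unique (leafLabellings F)
leafLabellings-unique []             = [] ∷ []
leafLabellings-unique (leaf ∷ F)     = Unique.map⁺ (λ { refl → refl }) (leafLabellings-unique F)
leafLabellings-unique (node _ _ ∷ F) = []

decForests-unique : ∀ m F → Unique (decForests m F)
decForests-unique zero    F = leafLabellings-unique F
decForests-unique (suc m) F =
  Unique.++⁺ (decForests-unique m F) (concatMap⁺ (picks-unique F) grafts-unique grafts-disjoint) old-new-disjoint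
  where
  x = + suc m
  grafts-unique : ∀ p → Unique (grafts m F p)
  grafts-unique p = Unique.map⁺ (graft-injective p x) (decForests-unique m (deleteRoot p))
  ∈-grafts⁻ : ∀ {p g} → g ∈ grafts m F p → ∃ λ h → AllDecLabels (+ m) h × g ≡ graft p x h
  ∈-grafts⁻ {p} g∈ with h , h∈ , g≡ ← ∈-map⁻ (graft p x) g∈ =
    h , proj₁ (decForests-sound m (deleteRoot p) h∈) , g≡
  grafts-disjoint : ∀ {p q g} → g ∈ grafts m F p → g ∈ grafts m F q → p ≡ q
  grafts-disjoint {p} {q} g∈p g∈q
    with h , dh , refl ← ∈-grafts⁻ g∈p
    with h′ , dh′ , e ← ∈-grafts⁻ g∈q
    = graft-pick-injective m p q dh dh′ e
  old-new-disjoint : ∀ {g} → ¬ (g ∈ decForests m F × g ∈ concatMap (grafts m F) (picks F))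
  old-new-disjoint {g} (g∈old , g∈new)
    with p , _ , g∈p ← find (∈-concatMap⁻ (grafts m F) {picks F} g∈new)
    with h , _ , refl ← ∈-grafts⁻ g∈p
    = 1+m≰m m (AllDecLabels-bounded g (proj₁ (decForests-sound m F g∈old))
                 (∈-resp-↭ (↭-sym (flattenAll-graft p x h)) (here refl)))

leafLabellings-count : ∀ F → length (leafLabellings F) * hookProducts F ≡ 0 ↓ sizes F
leafLabellings-count []             = refl
leafLabellings-count (leaf ∷ F)     = begin
  length (map (lleaf ∷_) (leafLabellings F)) * (1 * hookProducts F)
    ≡⟨ cong₂ _*_ (length-map (lleaf ∷_) (leafLabellings F)) (*-identityˡ _) ⟩
  length (leafLabellings F) * hookProducts F
    ≡⟨ leafLabellings-count F ⟩
  0 ↓ sizes F ∎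
leafLabellings-count (node l r ∷ F) = sym (m<n⇒m↓n≡0 0<n)
  where
  0<n : 0 < size (node l r) + sizes F
  0<n = ≤-trans (s≤s z≤n) (≤-trans (≤-reflexive (sym (+-suc (size l) (size r)))) (m≤m+n _ (sizes F)))

decForests-count : ∀ m F → length (decForests m F) * hookProducts F ≡ m ↓ sizes F
decForests-count zero    F = leafLabellings-count F
decForests-count (suc m) F = begin
  length (decForests m F ++ new) * H
    ≡⟨ cong (_* H) (length-++ (decForests m F)) ⟩
  (length (decForests m F) + length new) * H
    ≡⟨ *-distribʳ-+ H (length (decForests m F)) (length new) ⟩
  length (decForests m F) * H + length new * H
    ≡⟨ cong₂ _+_ (decForests-count m F) new-count ⟩
  m ↓ n + n * m ↓ pred n
    ≡⟨ pascal n ⟩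
  suc m ↓ n ∎
  where
  H = hookProducts F
  n = sizes F
  new = concatMap (grafts m F) (picks F)
  pascal : ∀ n → m ↓ n + n * m ↓ pred n ≡ suc m ↓ n
  pascal zero    = refl
  pascal (suc n) = sym (↓-pascal m n)
  graft-count : ∀ p → length (grafts m F p) * H ≡ pickedSize p * m ↓ pred n
  graft-count p = begin
    length (grafts m F p) * H
      ≡⟨ cong₂ _*_ (length-map _ (decForests m (deleteRoot p))) (hookProducts-deleteRoot p) ⟩
    length (decForests m F′) * (pickedSize p * hookProducts F′)
      ≡⟨ x∙yz≈y∙xz (length (decForests m F′)) (pickedSize p) _ ⟩
    pickedSize p * (length (decForests m F′) * hookProducts F′)
      ≡⟨ cong (pickedSize p *_) (decForests-count m F′) ⟩
    pickedSize p * m ↓ sizes F′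
      ≡⟨ cong (λ k → pickedSize p * m ↓ pred k) (sizes-deleteRoot p) ⟨
    pickedSize p * m ↓ pred n ∎
    where F′ = deleteRoot p
  new-count : length new * H ≡ n * m ↓ pred n
  new-count = begin
    length new * H
      ≡⟨ cong (_* H) (length-concatMap (grafts m F) (picks F)) ⟩
    sum (map (length ∘ grafts m F) (picks F)) * H
      ≡⟨ sum-map-*ʳ (length ∘ grafts m F) H (picks F) ⟨
    sum (map (λ p → length (grafts m F p) * H) (picks F))
      ≡⟨ cong sum (map-cong graft-count (picks F)) ⟩
    sum (map (λ p → pickedSize p * m ↓ pred n) (picks F))
      ≡⟨ sum-map-*ʳ pickedSize (m ↓ pred n) (picks F) ⟩
    sum (map pickedSize (picks F)) * m ↓ pred n
      ≡⟨ cong (_* m ↓ pred n) (sum-pickedSize F) ⟩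
    n * m ↓ pred n ∎

decCard : ∀ T M → 0 < size T → Σ ℕ λ d → HasCard (IsDec {T} M) d × d * hookProduct T ≡ M ↓ℤ size T
decCard T (+ m) _ = length D , card , count
  where
  D = decForests m (T ∷ [])
  head-injective : ∀ {g h : All Lab (T ∷ [])} → All.head g ≡ All.head h → g ≡ h
  head-injective {_ ∷ []} {_ ∷ []} refl = refl
  sound : ∀ {d} → d ∈ map All.head D → IsDec (+ m) d
  sound d∈
    with t ∷ [] , g∈ , refl ← ∈-map⁻ All.head d∈
    with (dt , _) , ug ← decForests-sound m _ g∈
    = dt , subst Unique (++-identityʳ (flatten t)) ug
  complete : ∀ {d} → IsDec (+ m) d → d ∈ map All.head D
  complete {d} (dd , ud) = ∈-map⁺ All.head
    (decForests-complete m _ (d ∷ []) ((dd , tt) , subst Unique (sym (++-identityʳ (flatten d))) ud))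
  card : HasCard (IsDec {T} (+ m)) (length D)
  card = record
    { elems    = map All.head D
    ; unique   = Unique.map⁺ head-injective (decForests-unique m (T ∷ []))
    ; sound    = sound
    ; complete = complete
    ; len      = length-map All.head D
    }
  count : length D * hookProduct T ≡ m ↓ size T
  count = begin
    length D * hookProduct T           ≡⟨ cong (length D *_) (*-identityʳ (hookProduct T)) ⟨
    length D * hookProducts (T ∷ [])   ≡⟨ decForests-count m (T ∷ []) ⟩
    m ↓ (size T + 0)                   ≡⟨ cong (m ↓_) (+-identityʳ (size T)) ⟩
    m ↓ size T                         ∎
decCard (node l r) -[1+ k ] 0<n = 0 , card , sym (M<n⇒M↓ℤn≡0 0<n -<+)
  where
  card : HasCard (IsDec {node l r} -[1+ k ]) 0
  card = record
    { elems    = []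
    ; unique   = []
    ; sound    = λ ()
    ; complete = λ { {lnode _ _ _} ((1≤x , x≤M , _) , _) → ⊥-elim (ℤ.≤⇒≯ (ℤ.≤-trans 1≤x x≤M) -<+) }
    ; len      = refl
    }

proposition3p14 : (T : Tree) (a : ℤ) → 0 < size T →
    Σ ℕ (λ n → HasCard (KappaOK {T} a) n × HasCard (IsDec {T} (maxSupp T a)) n
    × Σ ℕ (λ d → HasCard (IsDec {T} (+ (size T))) d
    × n ≡ chooseℤ (maxSupp T a) (size T) * d))
proposition3p14 T a 0<n
  with k , κ , k*h≡ ← kappaCard T a 0<n
  with d , δ , d*h≡ ← decCard T (maxSupp T a) 0<n
  with d′ , δ′ , d′*h≡ ← decCard T (+ size T) 0<n
  = k , κ , subst (HasCard (IsDec (maxSupp T a))) (sym k≡d) δ , d′ , δ′ , k≡C*d′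
  where
  M = maxSupp T a
  n = size T
  h = hookProduct T
  instance _ = hookProduct-nonZero T
  k≡d : k ≡ d
  k≡d = *-cancelʳ-≡ k d h (trans k*h≡ (sym d*h≡))
  k≡C*d′ : k ≡ chooseℤ M n * d′
  k≡C*d′ = *-cancelʳ-≡ k (chooseℤ M n * d′) h (begin
    k * h                   ≡⟨ k*h≡ ⟩
    M ↓ℤ n                  ≡⟨ chooseℤ*↓≡↓ℤ M n ⟨
    chooseℤ M n * n ↓ n     ≡⟨ cong (chooseℤ M n *_) d′*h≡ ⟨
    chooseℤ M n * (d′ * h)  ≡⟨ *-assoc (chooseℤ M n) d′ h ⟨
    chooseℤ M n * d′ * h    ∎)
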